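{- Let $l\geqslant 1$ be an integer and let $n\geqslant l+3$ be an integer. Then $$\kappa_l(n,3)=\begin{cases}\lfloor (n+l)/2\rfloor, & l+3\leqslant n<3l;\\ l+\lfloor n/3\rfloor, & n\geqslant \max\{3l,l+3\}.\end{cases}$$
   Context: For a positive integer $n$, $[n]=\{1,\ldots,n\}$. A family $\mathcal{F}$ of subsets of $[n]$ is an $m$-family if it has $m$ members (required to be pairwise distinct subsets); it is $k$-uniform if every member has size $k$; for a set $L$ of nonnegative integers it is $L$-intersecting if $|F\cap F'|\in L$ for every two distinct members $F,F'$. $\kappa_{L}(n,m)$ denotes the maximum $k$ such that there exists a $k$-uniform $L$-intersecting $m$-family of subsets of $[n]$ (and $-\infty$ if none exists), and $\kappa_l(n,m)$ denotes $\kappa_{\{l\}}(n,m)$. -}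

module Defs where

open import Data.Nat using (ℕ; _≤_; _<_)
open import Data.Fin using (Fin)
open import Data.Fin.Subset using (Subset; ∣_∣; _∩_)
open import Data.Product using (Σ; _×_)
open import Relation.Binary.PropositionalEquality using (_≡_; _≢_)
open import Level using (0ℓ; suc)

record UniformIntersectingFamily (L : ℕ → Set) (n m k : ℕ) : Set where
  field
    member    : Fin m → Subset n
    distinct  : ∀ i j → i ≢ j → member i ≢ member j
    uniform   : ∀ i → ∣ member i ∣ ≡ k
    intersect : ∀ i j → i ≢ j → L ∣ member i ∩ member j ∣

Singleton : ℕ → ℕ → Set
Singleton l x = x ≡ l

-- κ_L(n,m) = k  (k a natural number, i.e. the finite case):
-- k is realizable and is the maximum realizable uniformity.
κ[_]_,_≡_ : (L : ℕ → Set) → ℕ → ℕ → ℕ → Set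
κ[ L ] n , m ≡ k =
  UniformIntersectingFamily L n m k ×
  (∀ k′ → UniformIntersectingFamily L n m k′ → k′ ≤ k)

κₗ : ℕ → ℕ → ℕ → ℕ → Set
κₗ l n m k = κ[ Singleton l ] n , m ≡ k

module Submission where

-- For such sets A, B, C the sieve identity
--   3k = |A ∪ B ∪ C| + |(A ∪ B) ∩ C| + l
-- holds, and |A ∪ B ∪ C| ≤ n.  The overlap |(A ∪ B) ∩ C| is at most
-- |C| = k, giving 2k ≤ n + l, and at most |A ∩ C| + |B ∩ C| = 2l, giving
-- 3k ≤ n + 3l.  Hence k ≤ ⌊(n + l)/2⌋ and k ≤ l + ⌊n/3⌋ always.
--
-- Take the Venn diagram of three sets whose central region
-- has t points, whose three "exactly two sets" regions have p points each and
-- whose three "exactly one set" regions have q points each.  For p ≥ 1 this is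
-- a (t + 2p + q)-uniform {t + p}-intersecting 3-family on t + 3p + 3q points,
-- and padding by unused points embeds it in any larger ground set.  The choice
-- q = 0 attains ⌊(n + l)/2⌋ when n < 3l; the choice t = 0, p = l attains
-- l + ⌊n/3⌋ when n ≥ 3l.

open import Data.Bool using (_∧_)
open import Data.Fin using (Fin; zero; suc)
open import Data.Fin.Subset using (Subset; ∣_∣; _∩_; _∪_; ⊥; inside; outside)
open import Data.Fin.Subset.Properties
  using (∣p∣≤n; ∣p∩q∣≤∣q∣; ∣⊥∣≡0; ∣⊤∣≡n; ∩-idem; ∩-distribʳ-∪)
open import Data.Nat
open import Data.Nat.DivMod using (m*n/n≡m; m/n*n≤m; /-monoˡ-≤; m<n*o⇒m/o<n; +-distrib-/-∣ʳ)
open import Data.Nat.Divisibility using (n∣m*n)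
open import Data.Nat.Properties
open import Data.Nat.Tactic.RingSolver using (solve-∀)
open import Data.Product using (_×_; _,_)
open import Data.Vec using (Vec; []; _∷_; _++_; replicate; sum)
open import Data.Vec.Properties using (zipWith-++; zipWith-replicate; ++-injectiveˡ)
open import Defs
open import Relation.Binary.PropositionalEquality
open import Relation.Nullary using (contradiction)

Family₃ : ℕ → ℕ → ℕ → Set
Family₃ l n k = UniformIntersectingFamily (Singleton l) n 3 k

∣p∪q∣+∣p∩q∣ : ∀ {n} (p q : Subset n) → ∣ p ∪ q ∣ + ∣ p ∩ q ∣ ≡ ∣ p ∣ + ∣ q ∣
∣p∪q∣+∣p∩q∣ []            []            = refl
∣p∪q∣+∣p∩q∣ (outside ∷ p) (outside ∷ q) = ∣p∪q∣+∣p∩q∣ p q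
∣p∪q∣+∣p∩q∣ (outside ∷ p) (inside ∷ q)  =
  trans (cong suc (∣p∪q∣+∣p∩q∣ p q)) (sym (+-suc (∣ p ∣) (∣ q ∣)))
∣p∪q∣+∣p∩q∣ (inside ∷ p)  (outside ∷ q) = cong suc (∣p∪q∣+∣p∩q∣ p q)
∣p∪q∣+∣p∩q∣ (inside ∷ p)  (inside ∷ q)  = cong suc (begin
  ∣ p ∪ q ∣ + suc ∣ p ∩ q ∣ ≡⟨ +-suc (∣ p ∪ q ∣) (∣ p ∩ q ∣) ⟩
  suc (∣ p ∪ q ∣ + ∣ p ∩ q ∣) ≡⟨ cong suc (∣p∪q∣+∣p∩q∣ p q) ⟩
  suc (∣ p ∣ + ∣ q ∣)         ≡⟨ sym (+-suc (∣ p ∣) (∣ q ∣)) ⟩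
  ∣ p ∣ + suc ∣ q ∣           ∎)
  where open ≡-Reasoning

∣p∪q∣≤∣p∣+∣q∣ : ∀ {n} (p q : Subset n) → ∣ p ∪ q ∣ ≤ ∣ p ∣ + ∣ q ∣
∣p∪q∣≤∣p∣+∣q∣ p q = subst (∣ p ∪ q ∣ ≤_) (∣p∪q∣+∣p∩q∣ p q) (m≤m+n _ _)

sieve : ∀ {n} (A B C : Subset n) →
  ∣ A ∣ + ∣ B ∣ + ∣ C ∣ ≡ ∣ (A ∪ B) ∪ C ∣ + ∣ (A ∪ B) ∩ C ∣ + ∣ A ∩ B ∣
sieve A B C = begin
  ∣ A ∣ + ∣ B ∣ + ∣ C ∣                     ≡⟨ cong (_+ ∣ C ∣) (∣p∪q∣+∣p∩q∣ A B) ⟨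
  ∣ A ∪ B ∣ + ∣ A ∩ B ∣ + ∣ C ∣             ≡⟨ rotate (∣ A ∪ B ∣) (∣ A ∩ B ∣) (∣ C ∣) ⟩
  (∣ A ∪ B ∣ + ∣ C ∣) + ∣ A ∩ B ∣           ≡⟨ cong (_+ ∣ A ∩ B ∣) (∣p∪q∣+∣p∩q∣ (A ∪ B) C) ⟨
  ∣ (A ∪ B) ∪ C ∣ + ∣ (A ∪ B) ∩ C ∣ + ∣ A ∩ B ∣ ∎
  where
  open ≡-Reasoning
  rotate : ∀ a b c → a + b + c ≡ a + c + b
  rotate = solve-∀

-- Equal sets overlap fully, so a smaller overlap separates them.
overlap-separates : ∀ {n} (P Q : Subset n) → ∣ P ∩ Q ∣ < ∣ P ∣ → P ≢ Q
overlap-separates P Q small refl = <-irrefl (cong ∣_∣ (∩-idem P)) small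

∣++∣ : ∀ {m n} (P : Subset m) (Q : Subset n) → ∣ P ++ Q ∣ ≡ ∣ P ∣ + ∣ Q ∣
∣++∣ []            Q = refl
∣++∣ (outside ∷ P) Q = ∣++∣ P Q
∣++∣ (inside ∷ P)  Q = cong suc (∣++∣ P Q)

∩-++ : ∀ {m n} (P P′ : Subset m) (Q Q′ : Subset n) →
  (P ++ Q) ∩ (P′ ++ Q′) ≡ (P ∩ P′) ++ (Q ∩ Q′)
∩-++ P P′ Q Q′ = zipWith-++ _ P Q P′ Q′

module Bounds {l n k} (F : Family₃ l n k) where
  open UniformIntersectingFamily F

  A B C : Subset n
  A = member zero
  B = member (suc zero)
  C = member (suc (suc zero))

  covered : ℕ
  covered = ∣ (A ∪ B) ∩ C ∣

  counting : k + k + k ≤ n + covered + l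
  counting = begin
    k + k + k                                   ≡⟨ cong₂ (λ a b → a + b + k) (uniform zero) (uniform (suc zero)) ⟨
    ∣ A ∣ + ∣ B ∣ + k                           ≡⟨ cong (∣ A ∣ + ∣ B ∣ +_) (uniform (suc (suc zero))) ⟨
    ∣ A ∣ + ∣ B ∣ + ∣ C ∣                       ≡⟨ sieve A B C ⟩
    ∣ (A ∪ B) ∪ C ∣ + covered + ∣ A ∩ B ∣       ≡⟨ cong (∣ (A ∪ B) ∪ C ∣ + covered +_) (intersect zero (suc zero) (λ ())) ⟩
    ∣ (A ∪ B) ∪ C ∣ + covered + l               ≤⟨ +-monoˡ-≤ l (+-monoˡ-≤ covered (∣p∣≤n ((A ∪ B) ∪ C))) ⟩
    n + covered + l                             ∎
    where open ≤-Reasoning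

  covered≤k : covered ≤ k
  covered≤k = subst (covered ≤_) (uniform (suc (suc zero))) (∣p∩q∣≤∣q∣ (A ∪ B) C)

  covered≤2l : covered ≤ l + l
  covered≤2l = begin
    ∣ (A ∪ B) ∩ C ∣           ≡⟨ cong ∣_∣ (∩-distribʳ-∪ C A B) ⟩
    ∣ (A ∩ C) ∪ (B ∩ C) ∣     ≤⟨ ∣p∪q∣≤∣p∣+∣q∣ (A ∩ C) (B ∩ C) ⟩
    ∣ A ∩ C ∣ + ∣ B ∩ C ∣     ≡⟨ cong₂ _+_ (intersect zero (suc (suc zero)) (λ ()))
                                           (intersect (suc zero) (suc (suc zero)) (λ ())) ⟩
    l + l                     ∎
    where open ≤-Reasoning

  double-bound : k * 2 ≤ n + l
  double-bound = +-cancelʳ-≤ k (k * 2) (n + l) (begin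
    k * 2 + k         ≡⟨ three-k k ⟩
    k + k + k         ≤⟨ counting ⟩
    n + covered + l   ≤⟨ +-monoˡ-≤ l (+-monoʳ-≤ n covered≤k) ⟩
    n + k + l         ≡⟨ swap n k l ⟩
    n + l + k         ∎)
    where
    open ≤-Reasoning
    three-k : ∀ k → k * 2 + k ≡ k + k + k
    three-k = solve-∀
    swap : ∀ a b c → a + b + c ≡ a + c + b
    swap = solve-∀

  triple-bound : k * 3 ≤ n + l * 3
  triple-bound = begin
    k * 3             ≡⟨ three-k k ⟩
    k + k + k         ≤⟨ counting ⟩
    n + covered + l   ≤⟨ +-monoˡ-≤ l (+-monoʳ-≤ n covered≤2l) ⟩
    n + (l + l) + l   ≡⟨ three-l n l ⟩
    n + l * 3         ∎
    where
    open ≤-Reasoning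
    three-k : ∀ k → k * 3 ≡ k + k + k
    three-k = solve-∀
    three-l : ∀ n l → n + (l + l) + l ≡ n + l * 3
    three-l = solve-∀

-- Padding every member with unused points keeps sizes and intersections,
-- so a family on [m] yields one on [n] for every n ≥ m.
pad : ∀ {L : ℕ → Set} {m n s k} → UniformIntersectingFamily L m s k → m ≤ n →
      UniformIntersectingFamily L n s k
pad {L} {m} {s = s} F m≤n with m≤n⇒∃[o]m+o≡n m≤n
... | d , refl = record
  { member    = padded
  ; distinct  = λ i j i≢j eq → distinct i j i≢j (++-injectiveˡ (member i) (member j) eq)
  ; uniform   = λ i → trans (size (member i)) (uniform i)
  ; intersect = λ i j i≢j →
      subst L (sym (trans (cong ∣_∣ (padded-∩ i j)) (size (member i ∩ member j))))
              (intersect i j i≢j)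
  }
  where
  open UniformIntersectingFamily F
  padded : Fin s → Subset (m + d)
  padded i = member i ++ ⊥
  padded-∩ : ∀ i j → padded i ∩ padded j ≡ (member i ∩ member j) ++ ⊥
  padded-∩ i j = trans (∩-++ (member i) (member j) ⊥ ⊥)
                       (cong ((member i ∩ member j) ++_) (∩-idem ⊥))
  size : (P : Subset m) → ∣ P ++ ⊥ {d} ∣ ≡ ∣ P ∣
  size P = trans (∣++∣ P ⊥) (trans (cong (∣ P ∣ +_) (∣⊥∣≡0 d)) (+-identityʳ ∣ P ∣))

-- The subset of [s₁ + ⋯ + sⱼ] consisting of those consecutive blocks of
-- sizes s₁, …, sⱼ that are selected by a pattern in Subset j.
blocks : ∀ {j} (sizes : Vec ℕ j) → Subset j → Subset (sum sizes)
blocks []       []       = []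
blocks (s ∷ ss) (b ∷ bs) = replicate s b ++ blocks ss bs

weight : ∀ {j} → Vec ℕ j → Subset j → ℕ
weight []       []             = 0
weight (s ∷ ss) (outside ∷ bs) = weight ss bs
weight (s ∷ ss) (inside ∷ bs)  = s + weight ss bs

∣blocks∣ : ∀ {j} (ss : Vec ℕ j) (bs : Subset j) → ∣ blocks ss bs ∣ ≡ weight ss bs
∣blocks∣ []       []             = refl
∣blocks∣ (s ∷ ss) (outside ∷ bs) =
  trans (∣++∣ (replicate s outside) (blocks ss bs)) (cong₂ _+_ (∣⊥∣≡0 s) (∣blocks∣ ss bs))
∣blocks∣ (s ∷ ss) (inside ∷ bs)  =
  trans (∣++∣ (replicate s inside) (blocks ss bs)) (cong₂ _+_ (∣⊤∣≡n s) (∣blocks∣ ss bs))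

blocks-∩ : ∀ {j} (ss : Vec ℕ j) (bs cs : Subset j) →
  blocks ss bs ∩ blocks ss cs ≡ blocks ss (bs ∩ cs)
blocks-∩ []       []       []       = refl
blocks-∩ (s ∷ ss) (b ∷ bs) (c ∷ cs) =
  trans (∩-++ (replicate s b) (replicate s c) (blocks ss bs) (blocks ss cs))
        (cong₂ _++_ (zipWith-replicate _∧_ b c) (blocks-∩ ss bs cs))

-- The seven regions of a Venn diagram of three sets: the centre, the three
-- "exactly two sets" regions (AB, AC, BC) and the three "exactly one set"
-- regions (A, B, C), of sizes t, p and q respectively.
venn-sizes : ℕ → ℕ → ℕ → Vec ℕ 7
venn-sizes t p q = t ∷ p ∷ p ∷ p ∷ q ∷ q ∷ q ∷ []

venn-regions : Fin 3 → Subset 7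
venn-regions zero             = inside ∷ inside ∷ inside  ∷ outside ∷ inside  ∷ outside ∷ outside ∷ []
venn-regions (suc zero)       = inside ∷ inside ∷ outside ∷ inside  ∷ outside ∷ inside  ∷ outside ∷ []
venn-regions (suc (suc zero)) = inside ∷ outside ∷ inside ∷ inside  ∷ outside ∷ outside ∷ inside  ∷ []

-- Each set consists of the centre, two p-regions and one q-region.
venn-size : ∀ t p q i → weight (venn-sizes t p q) (venn-regions i) ≡ t + p + (p + q)
venn-size t p q zero             = normal-form t p q
  where normal-form : ∀ t p q → t + (p + (p + (q + 0))) ≡ t + p + (p + q)
        normal-form = solve-∀
venn-size t p q (suc zero)       = venn-size t p q zero
venn-size t p q (suc (suc zero)) = venn-size t p q zero

-- Two distinct sets share the centre and exactly one p-region.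
venn-overlap : ∀ t p q i j → i ≢ j →
  weight (venn-sizes t p q) (venn-regions i ∩ venn-regions j) ≡ t + p
venn-overlap t p q zero             zero             i≢j = contradiction refl i≢j
venn-overlap t p q zero             (suc zero)       _   = cong (t +_) (+-identityʳ p)
venn-overlap t p q zero             (suc (suc zero)) _   = cong (t +_) (+-identityʳ p)
venn-overlap t p q (suc zero)       zero             _   = cong (t +_) (+-identityʳ p)
venn-overlap t p q (suc zero)       (suc zero)       i≢j = contradiction refl i≢j
venn-overlap t p q (suc zero)       (suc (suc zero)) _   = cong (t +_) (+-identityʳ p)
venn-overlap t p q (suc (suc zero)) zero             _   = cong (t +_) (+-identityʳ p)
venn-overlap t p q (suc (suc zero)) (suc zero)       _   = cong (t +_) (+-identityʳ p)
venn-overlap t p q (suc (suc zero)) (suc (suc zero)) i≢j = contradiction refl i≢j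

-- The Venn family; p ≥ 1 makes its three members distinct.
venn : ∀ t p q → 1 ≤ p → Family₃ (t + p) (sum (venn-sizes t p q)) (t + p + (p + q))
venn t p q 1≤p = record
  { member    = member
  ; distinct  = λ i j i≢j → overlap-separates (member i) (member j)
                  (subst₂ _<_ (sym (intersect i j i≢j)) (sym (uniform i)) t+p<k)
  ; uniform   = uniform
  ; intersect = intersect
  }
  where
  member : Fin 3 → Subset (sum (venn-sizes t p q))
  member i = blocks (venn-sizes t p q) (venn-regions i)
  uniform : ∀ i → ∣ member i ∣ ≡ t + p + (p + q)
  uniform i = trans (∣blocks∣ (venn-sizes t p q) (venn-regions i)) (venn-size t p q i)
  intersect : ∀ i j → i ≢ j → ∣ member i ∩ member j ∣ ≡ t + p
  intersect i j i≢j = begin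
    ∣ member i ∩ member j ∣                                        ≡⟨ cong ∣_∣ (blocks-∩ (venn-sizes t p q) (venn-regions i) (venn-regions j)) ⟩
    ∣ blocks (venn-sizes t p q) (venn-regions i ∩ venn-regions j) ∣ ≡⟨ ∣blocks∣ (venn-sizes t p q) (venn-regions i ∩ venn-regions j) ⟩
    weight (venn-sizes t p q) (venn-regions i ∩ venn-regions j)    ≡⟨ venn-overlap t p q i j i≢j ⟩
    t + p                                                          ∎
    where open ≡-Reasoning
  t+p<k : t + p < t + p + (p + q)
  t+p<k = m<m+n (t + p) (≤-trans 1≤p (m≤m+n p q))

venn-realises : ∀ {l n k} t p q → 1 ≤ p → t + p ≡ l → l + (p + q) ≡ k →
  t + p * 3 + q * 3 ≤ n → Family₃ l n k
venn-realises {n = n} t p q 1≤p refl refl room =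
  pad (venn t p q 1≤p) (subst (_≤ n) (ground t p q) room)
  where
  ground : ∀ t p q → t + p * 3 + q * 3 ≡ t + (p + (p + (p + (q + (q + (q + 0))))))
  ground = solve-∀

-- Existence for l < k ≤ 2l and 2k ≤ n + l: the Venn family with
-- q = 0, p = k − l, t = 2l − k.
family-below : ∀ {l n k} → l < k → k ≤ l + l → k * 2 ≤ n + l → Family₃ l n k
family-below {l} {n} l<k k≤2l room with m≤n⇒∃[o]m+o≡n (<⇒≤ l<k)
... | p , refl with m≤n⇒∃[o]m+o≡n (+-cancelˡ-≤ l p l k≤2l)
... | t , refl = venn-realises t p 0 (gap-positive l<k) (+-comm t p)
                   (cong (p + t +_) (+-identityʳ p))
                   (+-cancelʳ-≤ (p + t) _ n (subst (_≤ n + (p + t)) (ground p t) room))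
  where
  gap-positive : ∀ {l p} → l < l + p → 1 ≤ p
  gap-positive {l} {p} l<l+p = +-cancelˡ-< l 0 p (subst (_< l + p) (sym (+-identityʳ l)) l<l+p)
  ground : ∀ p t → (p + t + p) * 2 ≡ t + p * 3 + 0 * 3 + (p + t)
  ground = solve-∀

-- Existence of k = l + d for 1 ≤ l ≤ d and 3d ≤ n: the Venn family with
-- t = 0, p = l, q = d − l.
family-above : ∀ {l n d} → 1 ≤ l → l ≤ d → d * 3 ≤ n → Family₃ l n (l + d)
family-above {l} {n} 1≤l l≤d room with m≤n⇒∃[o]m+o≡n l≤d
... | q , refl = venn-realises 0 l q 1≤l refl refl (subst (_≤ n) (ground l q) room)
  where
  ground : ∀ l q → (l + q) * 3 ≡ 0 + l * 3 + q * 3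
  ground = solve-∀

≤-quotient : ∀ {m o} d .{{_ : NonZero d}} → m * d ≤ o → m ≤ o / d
≤-quotient {m} {o} d m*d≤o = subst (_≤ o / d) (m*n/n≡m m d) (/-monoˡ-≤ d m*d≤o)

half-bound : ∀ {l n k} → Family₃ l n k → k ≤ (n + l) / 2
half-bound F = ≤-quotient 2 (Bounds.double-bound F)

third-bound : ∀ {l n k} → Family₃ l n k → k ≤ l + n / 3
third-bound {l} {n} {k} F = begin
  k                   ≤⟨ ≤-quotient 3 (Bounds.triple-bound F) ⟩
  (n + l * 3) / 3     ≡⟨ +-distrib-/-∣ʳ n (n∣m*n l) ⟩
  n / 3 + l * 3 / 3   ≡⟨ cong (n / 3 +_) (m*n/n≡m l 3) ⟩
  n / 3 + l           ≡⟨ +-comm (n / 3) l ⟩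
  l + n / 3           ∎
  where open ≤-Reasoning

-- For n ≥ l + 3 the value ⌊(n + l)/2⌋ exceeds l, so the gap p is positive.
half-above : ∀ {l n} → l + 3 ≤ n → l < (n + l) / 2
half-above {l} {n} l+3≤n = ≤-quotient 2 (begin
  suc l * 2   ≡⟨ double-suc l ⟩
  l + 2 + l   ≤⟨ +-monoˡ-≤ l (≤-trans (+-monoʳ-≤ l (n≤1+n 2)) l+3≤n) ⟩
  n + l       ∎)
  where
  open ≤-Reasoning
  double-suc : ∀ l → suc l * 2 ≡ l + 2 + l
  double-suc = solve-∀

-- For n < 3l the value ⌊(n + l)/2⌋ is at most 2l, so the centre t exists.
half-below : ∀ {l n} → n < 3 * l → (n + l) / 2 ≤ l + l
half-below {l} {n} n<3l =
  <⇒≤ (m<n*o⇒m/o<n (subst (n + l <_) (four-l l) (+-monoˡ-< l n<3l)))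
  where
  four-l : ∀ l → 3 * l + l ≡ (l + l) * 2
  four-l = solve-∀

theorem2p3 : (l n : ℕ) → 1 ≤ l → l + 3 ≤ n →
    ((n < 3 * l → κₗ l n 3 ((n + l) / 2)) ×
     ((3 * l) ⊔ (l + 3) ≤ n → κₗ l n 3 (l + n / 3)))
theorem2p3 l n 1≤l l+3≤n =
    (λ n<3l → family-below (half-above l+3≤n) (half-below n<3l) (m/n*n≤m (n + l) 2)
            , λ _ → half-bound)
  , (λ 3l≤n → family-above 1≤l (l≤n/3 3l≤n) (m/n*n≤m n 3)
            , λ _ → third-bound)
  where
  l≤n/3 : (3 * l) ⊔ (l + 3) ≤ n → l ≤ n / 3
  l≤n/3 h = ≤-quotient 3 (subst (_≤ n) (*-comm 3 l) (≤-trans (m≤m⊔n (3 * l) (l + 3)) h))
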